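{- Let $p,q\ge0$, $u\in S_p$, $v\in S_q$. Then the product in $\mathfrak{S}Sym$ can be written $$F_u\cdot F_v=\sum_{\iota\in S^{(p,q)}}F_{\sigma_\iota},$$ where $\sigma_\iota\in S_{p+q}$ is the permutation whose complete-graph tubing is $$T(\sigma_\iota)=\{\iota(t): t\in T(u)\}\cup\{\iota([p])\cup\hat\iota(s): s\in T(v)\};$$ i.e. $T((u\times v)\circ\iota^{ -1})$ equals the right-hand set for each $\iota\in S^{(p,q)}$.
   Context: $[n]=\{1,\dots,n\}$. $\mathfrak{S}Sym$ is the graded $\mathbb{Q}$-vector space with degree-$n$ basis $\{F_u: u\in S_n\}$ (and $1$ in degree 0), with product $F_u\cdot F_v=\sum_{\iota\in S^{(p,q)}}F_{(u\times v)\circ\iota^{ -1}}$ for $u\in S_p$, $v\in S_q$, where $S^{(p,q)}$ is the set of permutations $\iota$ of $[p+q]$ with $\iota(1)<\dots<\iota(p)$ and $\iota(p+1)<\dots<\iota(p+q)$, and $u\times v\in S_{p+q}$ is $(u(1),\dots,u(p),v(1)+p,\dots,v(q)+p)$. Write $\hat\iota(i)=\iota(p+i)$ for $i\in[q]$. For $\sigma\in S_n$, $T(\sigma)=\{\{i\in[n]:\sigma(i)\le k\}: k=1,\dots,n\}$; this is a bijection from $S_n$ to the maximal tubings ($n$-tubings) of the complete graph $K_n$ on nodes $1,\dots,n$ (a tubing being a set of pairwise nested-or-far-apart connected node sets containing the whole node set). -}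

module Defs where

open import Data.Nat using (ℕ; _+_)
open import Data.Bool using (Bool; true; false)
open import Data.Fin using (Fin; _↑ˡ_; _↑ʳ_; _<_; _≤?_; _≟_)
open import Data.Fin.Properties using (+↔⊎; any?)
open import Data.Fin.Permutation using (Permutation′; _⟨$⟩ʳ_; _∘ₚ_; flip)
open import Data.Fin.Subset using (Subset; _∪_; ⊤)
open import Data.Fin.Subset.Properties using (_∈?_)
open import Data.Sum.Function.Propositional using (_⊎-↔_)
open import Data.Product using (∃; _×_; Σ-syntax)
open import Data.Vec using (tabulate)
open import Function.Construct.Composition using (_↔-∘_)
open import Function.Construct.Symmetry using (↔-sym)
open import Relation.Nullary.Decidable using (⌊_⌋; _×-dec_)
open import Relation.Binary.PropositionalEquality using (_≡_)

-- S_n : permutations of Fin n (0-indexed version of [n])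
Perm : ℕ → Set
Perm n = Permutation′ n

-- u × v ∈ S_{p+q} :  i ↦ u(i) for i ∈ [p],  p + j ↦ p + v(j) for j ∈ [q]
_×ₚ_ : ∀ {p q} → Perm p → Perm q → Perm (p + q)
u ×ₚ v = ↔-sym +↔⊎ ↔-∘ ((u ⊎-↔ v) ↔-∘ +↔⊎)

-- composition σ ∘ τ in the usual (right-to-left) sense: (σ ∘ τ)(i) = σ(τ(i))
_∘ᵖ_ : ∀ {n} → Perm n → Perm n → Perm n
σ ∘ᵖ τ = τ ∘ₚ σ

_⁻¹ : ∀ {n} → Perm n → Perm n
ι ⁻¹ = flip ι

IsShuffle : ∀ p q → Perm (p + q) → Set
IsShuffle p q ι =
  (∀ (i j : Fin p) → i < j → (ι ⟨$⟩ʳ (i ↑ˡ q)) < (ι ⟨$⟩ʳ (j ↑ˡ q))) ×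
  (∀ (i j : Fin q) → i < j → (ι ⟨$⟩ʳ (p ↑ʳ i)) < (ι ⟨$⟩ʳ (p ↑ʳ j)))

-- ι restricted to the first p nodes, and ι̂(i) = ι(p+i)
ιL : ∀ {p q} → Perm (p + q) → Fin p → Fin (p + q)
ιL {p} {q} ι i = ι ⟨$⟩ʳ (i ↑ˡ q)

ιR : ∀ {p q} → Perm (p + q) → Fin q → Fin (p + q)
ιR {p} {q} ι j = ι ⟨$⟩ʳ (p ↑ʳ j)

image : ∀ {m n} → (Fin m → Fin n) → Subset m → Subset n
image f t = tabulate λ y → ⌊ any? (λ i → (i ∈? t) ×-dec (f i ≟ y)) ⌋

-- the k-th tube of σ (k = 0..n-1, i.e. k+1 in 1-indexed terms):
-- { i : σ(i) ≤ k }
tube : ∀ {n} → Perm n → Fin n → Subset n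
tube σ k = tabulate λ i → ⌊ (σ ⟨$⟩ʳ i) ≤? k ⌋

_∈T_ : ∀ {n} → Subset n → Perm n → Set
S ∈T σ = ∃ λ k → S ≡ tube σ k

InRHS : ∀ {p q} → Perm p → Perm q → Perm (p + q) → Subset (p + q) → Set
InRHS {p} {q} u v ι S =
  (Σ[ t ∈ Subset p ] (t ∈T u × S ≡ image (ιL {p} {q} ι) t)) Data.Sum.⊎
  (Σ[ s ∈ Subset q ] (s ∈T v × S ≡ (image (ιL {p} {q} ι) ⊤ ∪ image (ιR {p} {q} ι) s)))
  where import Data.Sum

module Submission where

-- Write σ = (u × v) ∘ ι⁻¹ and think of a tube of σ as the
-- sublevel set {i : σ(i) ≤ k}.  Precomposing a permutation with ι⁻¹ transports
-- each sublevel set along ι:  tube (σ ∘ ι⁻¹) k = ι(tube σ k).  For the block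
-- permutation u × v the sublevel sets are explicit: at a level k in the first
-- block [p] they are the tubes of u, and at a level p + m in the second block
-- they are all of [p] together with the shifted tubes of v.  Transporting these
-- along ι (images commute with composition and unions) gives exactly the two
-- families ι(t), t ∈ T(u), and ι([p]) ∪ ι̂(s), s ∈ T(v).  The argument never uses
-- that ι is a shuffle: the tube description holds for every ι ∈ S_{p+q}.

open import Defs
open import Data.Nat using (ℕ; _+_)
import Data.Nat as ℕ
import Data.Nat.Properties as ℕ
open import Data.Fin using (Fin; toℕ; _↑ˡ_; _↑ʳ_; _≤_; _<_; _≤?_; splitAt)
open import Data.Fin.Properties
  using (toℕ-↑ˡ; toℕ-↑ʳ; toℕ<n; ↑ˡ-injective; ↑ʳ-injective; <⇒≢;
         splitAt-↑ˡ; splitAt-↑ʳ; splitAt⁻¹-↑ˡ; splitAt⁻¹-↑ʳ)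
open import Data.Fin.Permutation using (_⟨$⟩ʳ_; _⟨$⟩ˡ_; inverseˡ; inverseʳ)
open import Data.Fin.Subset using (Subset; _∈_; _∉_; ⊤; _∪_)
open import Data.Fin.Subset.Properties using (∈⊤; ⊆-antisym; x∈p∪q⁺; x∈p∪q⁻)
open import Data.Vec using (tabulate)
open import Data.Vec.Properties using (lookup∘tabulate; []=⇒lookup; lookup⇒[]=)
open import Data.Bool.Properties using (T-≡)
open import Data.Sum using (inj₁; inj₂; [_,_]) renaming (map to map⊎)
open import Data.Product using (∃; _×_; _,_)
open import Function using (_∘_)
open import Function.Bundles using (_⇔_; mk⇔; Equivalence)
open import Function.Properties.Equivalence using () renaming (sym to ⇔-sym)
open import Function.Related.Propositional using (module EquationalReasoning; equivalence)
open import Relation.Nullary using (contradiction)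
open import Relation.Nullary.Decidable using (⌊_⌋; toWitness; fromWitness)
open import Relation.Unary using (Pred; Decidable)
open import Relation.Binary.PropositionalEquality
  using (_≡_; refl; sym; trans; cong; cong₂; subst; subst₂; module ≡-Reasoning)

open Equivalence using (to; from)

∈-comprehension : ∀ {n ℓ} {P : Pred (Fin n) ℓ} (P? : Decidable P) {i : Fin n} →
                  i ∈ tabulate (λ j → ⌊ P? j ⌋) ⇔ P i
∈-comprehension P? {i} = mk⇔
  (λ i∈ → toWitness (T-≡ .from (trans (sym (lookup∘tabulate _ i)) ([]=⇒lookup i∈))))
  (λ Pi → lookup⇒[]= i _ (trans (lookup∘tabulate _ i) (T-≡ .to (fromWitness Pi))))

∈-tube : ∀ {n} (σ : Perm n) (k : Fin n) {i : Fin n} → i ∈ tube σ k ⇔ (σ ⟨$⟩ʳ i) ≤ k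
∈-tube σ k = ∈-comprehension (λ i → (σ ⟨$⟩ʳ i) ≤? k)

∈-image : ∀ {m n} (f : Fin m → Fin n) (t : Subset m) {y : Fin n} →
          y ∈ image f t ⇔ (∃ λ i → i ∈ t × f i ≡ y)
∈-image f t = ∈-comprehension _

image-∘ : ∀ {l m n} (g : Fin m → Fin n) (f : Fin l → Fin m) (t : Subset l) →
          image (g ∘ f) t ≡ image g (image f t)
image-∘ g f t = ⊆-antisym
  (λ y∈ → let (i , i∈t , gfi≡y) = ∈-image (g ∘ f) t .to y∈
          in ∈-image g (image f t) .from (f i , ∈-image f t .from (i , i∈t , refl) , gfi≡y))
  (λ y∈ → let (j , j∈ft , gj≡y) = ∈-image g (image f t) .to y∈
              (i , i∈t , fi≡j)  = ∈-image f t .to j∈ft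
          in ∈-image (g ∘ f) t .from (i , i∈t , trans (cong g fi≡j) gj≡y))

image-∪ : ∀ {m n} (g : Fin m → Fin n) (s t : Subset m) →
          image g (s ∪ t) ≡ image g s ∪ image g t
image-∪ g s t = ⊆-antisym
  (λ y∈ → let (i , i∈s∪t , gi≡y) = ∈-image g (s ∪ t) .to y∈ in
     x∈p∪q⁺ (map⊎ (λ i∈s → ∈-image g s .from (i , i∈s , gi≡y))
                  (λ i∈t → ∈-image g t .from (i , i∈t , gi≡y))
                  (x∈p∪q⁻ s t i∈s∪t)))
  (λ y∈ → [ (λ y∈s → let (i , i∈s , gi≡y) = ∈-image g s .to y∈s
                     in ∈-image g (s ∪ t) .from (i , x∈p∪q⁺ (inj₁ i∈s) , gi≡y))
          , (λ y∈t → let (i , i∈t , gi≡y) = ∈-image g t .to y∈t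
                     in ∈-image g (s ∪ t) .from (i , x∈p∪q⁺ (inj₂ i∈t) , gi≡y))
          ] (x∈p∪q⁻ (image g s) (image g t) y∈))

-- Transport of tubes: the sublevel sets of σ ∘ ι⁻¹ are the images under ι of
-- the sublevel sets of σ, since σ(ι⁻¹(y)) ≤ k iff y = ι(i) with σ(i) ≤ k.
tube-∘⁻¹ : ∀ {n} (σ ι : Perm n) (k : Fin n) →
           tube (σ ∘ᵖ (ι ⁻¹)) k ≡ image (ι ⟨$⟩ʳ_) (tube σ k)
tube-∘⁻¹ σ ι k = ⊆-antisym
  (λ {y} y∈ → ∈-image (ι ⟨$⟩ʳ_) (tube σ k) .from
     (ι ⟨$⟩ˡ y , ∈-tube σ k .from (∈-tube (σ ∘ᵖ (ι ⁻¹)) k .to y∈) , inverseʳ ι))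
  (λ y∈ → let (i , i∈ , ιi≡y) = ∈-image (ι ⟨$⟩ʳ_) (tube σ k) .to y∈ in
     ∈-tube (σ ∘ᵖ (ι ⁻¹)) k .from
       (subst (λ y → (σ ⟨$⟩ʳ (ι ⟨$⟩ˡ y)) ≤ k) ιi≡y
         (subst (λ j → (σ ⟨$⟩ʳ j) ≤ k) (sym (inverseˡ ι)) (∈-tube σ k .to i∈))))

data Block (p q : ℕ) : Fin (p + q) → Set where
  first  : (a : Fin p) → Block p q (a ↑ˡ q)
  second : (b : Fin q) → Block p q (p ↑ʳ b)

block : ∀ p q (z : Fin (p + q)) → Block p q z
block p q z with splitAt p {q} z in eq
... | inj₁ a = subst (Block p q) (splitAt⁻¹-↑ˡ eq) (first a)
... | inj₂ b = subst (Block p q) (splitAt⁻¹-↑ʳ eq) (second b)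

×ₚ-first : ∀ {p q} (u : Perm p) (v : Perm q) (a : Fin p) →
           (u ×ₚ v) ⟨$⟩ʳ (a ↑ˡ q) ≡ (u ⟨$⟩ʳ a) ↑ˡ q
×ₚ-first {p} {q} u v a rewrite splitAt-↑ˡ p a q = refl

×ₚ-second : ∀ {p q} (u : Perm p) (v : Perm q) (b : Fin q) →
            (u ×ₚ v) ⟨$⟩ʳ (p ↑ʳ b) ≡ p ↑ʳ (v ⟨$⟩ʳ b)
×ₚ-second {p} {q} u v b rewrite splitAt-↑ʳ p q b = refl

↑ˡ-≤-↑ˡ : ∀ {p} q {a b : Fin p} → a ↑ˡ q ≤ b ↑ˡ q ⇔ a ≤ b
↑ˡ-≤-↑ˡ q {a} {b} = mk⇔ (subst₂ ℕ._≤_ (toℕ-↑ˡ a q) (toℕ-↑ˡ b q))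
                         (subst₂ ℕ._≤_ (sym (toℕ-↑ˡ a q)) (sym (toℕ-↑ˡ b q)))

↑ʳ-≤-↑ʳ : ∀ p {q} {a b : Fin q} → p ↑ʳ a ≤ p ↑ʳ b ⇔ a ≤ b
↑ʳ-≤-↑ʳ p {q} {a} {b} = mk⇔
  (ℕ.+-cancelˡ-≤ p _ _ ∘ subst₂ ℕ._≤_ (toℕ-↑ʳ p a) (toℕ-↑ʳ p b))
  (subst₂ ℕ._≤_ (sym (toℕ-↑ʳ p a)) (sym (toℕ-↑ʳ p b)) ∘ ℕ.+-monoʳ-≤ p)

↑ˡ-<-↑ʳ : ∀ {p q} (a : Fin p) (b : Fin q) → a ↑ˡ q < p ↑ʳ b
↑ˡ-<-↑ʳ {p} {q} a b = subst₂ ℕ._<_ (sym (toℕ-↑ˡ a q)) (sym (toℕ-↑ʳ p b))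
  (ℕ.<-≤-trans (toℕ<n a) (ℕ.m≤m+n p (toℕ b)))

↑ˡ-∈-image : ∀ {p} q (t : Subset p) {a : Fin p} → a ↑ˡ q ∈ image (_↑ˡ q) t ⇔ a ∈ t
↑ˡ-∈-image q t {a} = mk⇔
  (λ a∈ → let (i , i∈t , i≡a) = ∈-image (_↑ˡ q) t .to a∈
          in subst (_∈ t) (↑ˡ-injective q i a i≡a) i∈t)
  (λ a∈t → ∈-image (_↑ˡ q) t .from (a , a∈t , refl))

↑ʳ-∈-image : ∀ p {q} (s : Subset q) {b : Fin q} → p ↑ʳ b ∈ image (p ↑ʳ_) s ⇔ b ∈ s
↑ʳ-∈-image p s {b} = mk⇔
  (λ b∈ → let (i , i∈s , i≡b) = ∈-image (p ↑ʳ_) s .to b∈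
          in subst (_∈ s) (↑ʳ-injective p i b i≡b) i∈s)
  (λ b∈s → ∈-image (p ↑ʳ_) s .from (b , b∈s , refl))

↑ʳ-∉-image-↑ˡ : ∀ {p} q (t : Subset p) (b : Fin q) → p ↑ʳ b ∉ image (_↑ˡ q) t
↑ʳ-∉-image-↑ˡ q t b b∈ = let (i , _ , i≡b) = ∈-image (_↑ˡ q) t .to b∈
                          in <⇒≢ (↑ˡ-<-↑ʳ i b) i≡b

∈-∪-avoiding : ∀ {n} {s t : Subset n} {x : Fin n} → x ∉ s → x ∈ t ⇔ x ∈ s ∪ t
∈-∪-avoiding {s = s} {t} x∉s =
  mk⇔ (x∈p∪q⁺ ∘ inj₂) (λ x∈ → [ (λ x∈s → contradiction x∈s x∉s) , (λ x∈t → x∈t) ] (x∈p∪q⁻ s t x∈))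

block-ext : ∀ {p q} {s t : Subset (p + q)} →
            (∀ a → a ↑ˡ q ∈ s ⇔ a ↑ˡ q ∈ t) → (∀ b → p ↑ʳ b ∈ s ⇔ p ↑ʳ b ∈ t) → s ≡ t
block-ext {p} {q} {s} {t} on-first on-second =
  ⊆-antisym (λ {z} → on-block z .to) (λ {z} → on-block z .from)
  where
  on-block : ∀ z → z ∈ s ⇔ z ∈ t
  on-block z with block p q z
  ... | first a  = on-first a
  ... | second b = on-second b

module _ {p q : ℕ} (u : Perm p) (v : Perm q) where
  open EquationalReasoning {k = equivalence}

  tube-×ₚ-first : ∀ k → tube (u ×ₚ v) (k ↑ˡ q) ≡ image (_↑ˡ q) (tube u k)
  tube-×ₚ-first k = block-ext on-first on-second
    where
    on-first : ∀ a → a ↑ˡ q ∈ tube (u ×ₚ v) (k ↑ˡ q) ⇔ a ↑ˡ q ∈ image (_↑ˡ q) (tube u k)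
    on-first a = begin
      a ↑ˡ q ∈ tube (u ×ₚ v) (k ↑ˡ q)      ∼⟨ ∈-tube (u ×ₚ v) (k ↑ˡ q) ⟩
      (u ×ₚ v) ⟨$⟩ʳ (a ↑ˡ q) ≤ k ↑ˡ q      ≡⟨ cong (_≤ k ↑ˡ q) (×ₚ-first u v a) ⟩
      (u ⟨$⟩ʳ a) ↑ˡ q ≤ k ↑ˡ q             ∼⟨ ↑ˡ-≤-↑ˡ q ⟩
      u ⟨$⟩ʳ a ≤ k                         ∼⟨ ⇔-sym (∈-tube u k) ⟩
      a ∈ tube u k                         ∼⟨ ⇔-sym (↑ˡ-∈-image q (tube u k)) ⟩
      a ↑ˡ q ∈ image (_↑ˡ q) (tube u k)    ∎

    -- a node of the second block is above every level of the first block
    on-second : ∀ b → p ↑ʳ b ∈ tube (u ×ₚ v) (k ↑ˡ q) ⇔ p ↑ʳ b ∈ image (_↑ˡ q) (tube u k)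
    on-second b = mk⇔
      (λ b∈ → contradiction (subst (_≤ k ↑ˡ q) (×ₚ-second u v b) (∈-tube (u ×ₚ v) (k ↑ˡ q) .to b∈))
                            (ℕ.<⇒≱ (↑ˡ-<-↑ʳ k (v ⟨$⟩ʳ b))))
      (λ b∈ → contradiction b∈ (↑ʳ-∉-image-↑ˡ q (tube u k) b))

  tube-×ₚ-second : ∀ m → tube (u ×ₚ v) (p ↑ʳ m) ≡ image (_↑ˡ q) ⊤ ∪ image (p ↑ʳ_) (tube v m)
  tube-×ₚ-second m = block-ext on-first on-second
    where
    -- every node of the first block is below every level of the second block
    on-first : ∀ a → a ↑ˡ q ∈ tube (u ×ₚ v) (p ↑ʳ m) ⇔ a ↑ˡ q ∈ image (_↑ˡ q) ⊤ ∪ image (p ↑ʳ_) (tube v m)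
    on-first a = mk⇔
      (λ _ → x∈p∪q⁺ (inj₁ (↑ˡ-∈-image q ⊤ .from ∈⊤)))
      (λ _ → ∈-tube (u ×ₚ v) (p ↑ʳ m) .from
               (subst (_≤ p ↑ʳ m) (sym (×ₚ-first u v a)) (ℕ.<⇒≤ (↑ˡ-<-↑ʳ (u ⟨$⟩ʳ a) m))))

    on-second : ∀ b → p ↑ʳ b ∈ tube (u ×ₚ v) (p ↑ʳ m) ⇔ p ↑ʳ b ∈ image (_↑ˡ q) ⊤ ∪ image (p ↑ʳ_) (tube v m)
    on-second b = begin
      p ↑ʳ b ∈ tube (u ×ₚ v) (p ↑ʳ m)      ∼⟨ ∈-tube (u ×ₚ v) (p ↑ʳ m) ⟩
      (u ×ₚ v) ⟨$⟩ʳ (p ↑ʳ b) ≤ p ↑ʳ m      ≡⟨ cong (_≤ p ↑ʳ m) (×ₚ-second u v b) ⟩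
      p ↑ʳ (v ⟨$⟩ʳ b) ≤ p ↑ʳ m             ∼⟨ ↑ʳ-≤-↑ʳ p ⟩
      v ⟨$⟩ʳ b ≤ m                         ∼⟨ ⇔-sym (∈-tube v m) ⟩
      b ∈ tube v m                         ∼⟨ ⇔-sym (↑ʳ-∈-image p (tube v m)) ⟩
      p ↑ʳ b ∈ image (p ↑ʳ_) (tube v m)    ∼⟨ ∈-∪-avoiding (↑ʳ-∉-image-↑ˡ q ⊤ b) ⟩
      p ↑ʳ b ∈ image (_↑ˡ q) ⊤ ∪ image (p ↑ʳ_) (tube v m) ∎

module _ {p q : ℕ} (u : Perm p) (v : Perm q) (ι : Perm (p + q)) where
  open ≡-Reasoning

  tube-first : ∀ k → tube ((u ×ₚ v) ∘ᵖ (ι ⁻¹)) (k ↑ˡ q) ≡ image (ιL {p} {q} ι) (tube u k)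
  tube-first k = begin
    tube ((u ×ₚ v) ∘ᵖ (ι ⁻¹)) (k ↑ˡ q)
      ≡⟨ tube-∘⁻¹ (u ×ₚ v) ι (k ↑ˡ q) ⟩
    image (ι ⟨$⟩ʳ_) (tube (u ×ₚ v) (k ↑ˡ q))
      ≡⟨ cong (image (ι ⟨$⟩ʳ_)) (tube-×ₚ-first u v k) ⟩
    image (ι ⟨$⟩ʳ_) (image (_↑ˡ q) (tube u k))
      ≡⟨ image-∘ (ι ⟨$⟩ʳ_) (_↑ˡ q) (tube u k) ⟨
    image (ιL {p} {q} ι) (tube u k)
      ∎

  tube-second : ∀ m → tube ((u ×ₚ v) ∘ᵖ (ι ⁻¹)) (p ↑ʳ m) ≡
                       image (ιL {p} {q} ι) ⊤ ∪ image (ιR {p} {q} ι) (tube v m)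
  tube-second m = begin
    tube ((u ×ₚ v) ∘ᵖ (ι ⁻¹)) (p ↑ʳ m)
      ≡⟨ tube-∘⁻¹ (u ×ₚ v) ι (p ↑ʳ m) ⟩
    image (ι ⟨$⟩ʳ_) (tube (u ×ₚ v) (p ↑ʳ m))
      ≡⟨ cong (image (ι ⟨$⟩ʳ_)) (tube-×ₚ-second u v m) ⟩
    image (ι ⟨$⟩ʳ_) (image (_↑ˡ q) ⊤ ∪ image (p ↑ʳ_) (tube v m))
      ≡⟨ image-∪ (ι ⟨$⟩ʳ_) (image (_↑ˡ q) ⊤) (image (p ↑ʳ_) (tube v m)) ⟩
    image (ι ⟨$⟩ʳ_) (image (_↑ˡ q) ⊤) ∪ image (ι ⟨$⟩ʳ_) (image (p ↑ʳ_) (tube v m))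
      ≡⟨ cong₂ _∪_ (image-∘ (ι ⟨$⟩ʳ_) (_↑ˡ q) ⊤) (image-∘ (ι ⟨$⟩ʳ_) (p ↑ʳ_) (tube v m)) ⟨
    image (ιL {p} {q} ι) ⊤ ∪ image (ιR {p} {q} ι) (tube v m)
      ∎

theorem4p1 : (p q : ℕ) (u : Perm p) (v : Perm q) (ι : Perm (p + q)) →
    IsShuffle p q ι →
    (S : Subset (p + q)) → (S ∈T ((u ×ₚ v) ∘ᵖ (ι ⁻¹)) ⇔ InRHS u v ι S)
theorem4p1 p q u v ι _ S = mk⇔ to-RHS from-RHS
  where
  to-RHS : S ∈T ((u ×ₚ v) ∘ᵖ (ι ⁻¹)) → InRHS u v ι S
  to-RHS (k , S≡) with block p q k
  ... | first a  = inj₁ (tube u a , (a , refl) , trans S≡ (tube-first u v ι a))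
  ... | second b = inj₂ (tube v b , (b , refl) , trans S≡ (tube-second u v ι b))

  from-RHS : InRHS u v ι S → S ∈T ((u ×ₚ v) ∘ᵖ (ι ⁻¹))
  from-RHS (inj₁ (_ , (a , refl) , S≡)) = a ↑ˡ q , trans S≡ (sym (tube-first u v ι a))
  from-RHS (inj₂ (_ , (b , refl) , S≡)) = p ↑ʳ b , trans S≡ (sym (tube-second u v ι b))
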